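{- Let $p\geq3$ be a prime. (a) For every $n\geq1$, the map $\mathbb{B}_n:\mathbb{Z}^n\to\mathbb{Z}^n$, $(x_1,\dots,x_n)\mapsto(B_1(x_1),B_2(x_1,x_2),\dots,B_n(x_1,\dots,x_n))$ is bijective. (b) Let $\delta_j=1$ for $j\leq p-1$ and $\delta_j=0$ for $j\geq p$, and let $1\leq i\leq p-1$. Then $$\mathbb{B}_{p+i}^{ -1}(\delta_1,\dots,\delta_{p+i})=(1,0,\dots,0,-1,\mathfrak{x}_{p+1},\dots,\mathfrak{x}_{p+i}),$$ where the entry $-1$ is in position $p$, the entries in positions $2,\dots,p-1$ are $0$, and the integers $\mathfrak{x}_{p+k}$ satisfy $\mathfrak{x}_{p+k}\equiv\frac{(-1)^{k+1}p}{k}\pmod{p^2}$ for $1\leq k\leq i$.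
   Context: For integers $n\geq k\geq0$, the incomplete exponential Bell polynomial is $B_{n,k}(x_1,\dots,x_{n-k+1})=\sum \frac{n!}{j_1!\cdots j_{n-k+1}!}\prod_{i=1}^{n-k+1}\left(\frac{x_i}{i!}\right)^{j_i}$, the sum over $(j_1,\dots,j_{n-k+1})\in\mathbb{N}^{n-k+1}$ with $\sum j_i=k$ and $\sum i j_i=n$. The $n$-th complete Bell polynomial is $B_n(x_1,\dots,x_n)=\sum_{k=1}^nB_{n,k}(x_1,\dots,x_{n-k+1})$ (it has integer coefficients). The congruence mod $p^2$ is in $\mathbb{Z}_{(p)}$. -}

module Defs where

open import Data.Nat as ℕ using (ℕ; zero; suc; _!; NonZero; _≟_; _≤ᵇ_)
open import Data.Nat.Properties using (_!≢0; m*n≢0; m^n≢0)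
open import Data.Integer as ℤ using (ℤ; +_)
open import Data.Rational as ℚ using (ℚ; ↧ₙ_)
open import Data.Nat.Divisibility using (_∣_)
open import Data.List as List using (List; []; _∷_; concatMap; upTo; filter)
open import Data.Vec as Vec using (Vec; []; _∷_; tabulate)
open import Data.Fin using (Fin; toℕ)
open import Data.Bool using (if_then_else_)
open import Data.Product using (Σ; _×_)
open import Relation.Nullary using (¬_)
open import Relation.Nullary.Decidable using (_×-dec_)
open import Relation.Binary.PropositionalEquality using (_≡_)

-- Multi-indices (j_s, j_{s+1}, ...) are vectors of naturals; the first
-- entry carries index s (we always start with s = 1).

tuples : (m b : ℕ) → List (Vec ℕ m)
tuples zero    b = [] ∷ []
tuples (suc m) b = concatMap (λ j → List.map (j ∷_) (tuples m b)) (upTo (suc b))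

wsum : ∀ {m} → ℕ → Vec ℕ m → ℕ
wsum s []       = 0
wsum s (j ∷ js) = s ℕ.* j ℕ.+ wsum (suc s) js

denom : ∀ {m} → ℕ → Vec ℕ m → ℕ
denom s []       = 1
denom s (j ∷ js) = (j ! ℕ.* (s !) ℕ.^ j) ℕ.* denom (suc s) js

denom≢0 : ∀ {m} (s : ℕ) (js : Vec ℕ m) → NonZero (denom s js)
denom≢0 s []       = _
denom≢0 s (j ∷ js) =
  let instance _ = j !≢0
               _ = s !≢0
               _ = m^n≢0 (s !) j
               _ = m*n≢0 (j !) ((s !) ℕ.^ j)
               _ = denom≢0 (suc s) js
  in m*n≢0 (j ! ℕ.* (s !) ℕ.^ j) (denom (suc s) js)

mono : ∀ {m} → (ℕ → ℤ) → ℕ → Vec ℕ m → ℤ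
mono x s []       = ℤ.+ 1
mono x s (j ∷ js) = (x s ℤ.^ j) ℤ.* mono x (suc s) js

-- the (exact, integral) multinomial coefficient  n! / Π j_i! (i!)^{j_i}
coeff : ∀ {m} → ℕ → Vec ℕ m → ℕ
coeff n js = ℕ._/_ (n !) (denom 1 js) {{denom≢0 1 js}}

sumℤ : List ℤ → ℤ
sumℤ = List.foldr ℤ._+_ (ℤ.+ 0)

-- The variables are given as a function x : ℕ → ℤ, with x i = x_i (i ≥ 1).
-- The sum ranges over (j_1,…,j_{n-k+1}) ∈ ℕ^{n-k+1} with Σ j_i = k and
-- Σ i j_i = n (every such tuple has all entries ≤ k).
partialBell : (n k : ℕ) → (ℕ → ℤ) → ℤ
partialBell n k x =
  sumℤ (List.map (λ js → (+ coeff n js) ℤ.* mono x 1 js)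
                 (filter (λ js → (Vec.sum js ≟ k) ×-dec (wsum 1 js ≟ n))
                         (tuples (suc (n ℕ.∸ k)) k)))

completeBell : ℕ → (ℕ → ℤ) → ℤ
completeBell n x = sumℤ (List.map (λ k → partialBell n (suc k) x) (upTo n))

-- 1-indexed entries of a vector: entry xs i = x_i for 1 ≤ i ≤ n, 0 otherwise
entry : ∀ {n} → Vec ℤ n → ℕ → ℤ
entry []       _             = + 0
entry (x ∷ xs) zero          = + 0
entry (x ∷ xs) (suc zero)    = x
entry (x ∷ xs) (suc (suc i)) = entry xs (suc i)

𝔹 : (n : ℕ) → Vec ℤ n → Vec ℤ n
𝔹 n xs = tabulate (λ (i : Fin n) → completeBell (suc (toℕ i)) (entry xs))

δ : ℕ → ℕ → ℤ
δ p j = if j ≤ᵇ p ℕ.∸ 1 then + 1 else + 0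

δvec : ℕ → (N : ℕ) → Vec ℤ N
δvec p N = tabulate (λ (i : Fin N) → δ p (suc (toℕ i)))

-- Congruence mod p² in ℤ_(p):  a ≡ b (mod p² ℤ_(p)) iff a - b = p² c for
-- some c ∈ ℤ_(p), where c ∈ ℤ_(p) iff p does not divide the (reduced)
-- denominator of c.

InZ₍p₎ : ℕ → ℚ → Set
InZ₍p₎ p c = ¬ (p ∣ ↧ₙ c)

CongModSq : ℕ → ℚ → ℚ → Set
CongModSq p a b = Σ ℚ (λ c → InZ₍p₎ p c × a ℚ.- b ≡ ((+ (p ℕ.* p)) ℚ./ 1) ℚ.* c)

-- 𝔹 is triangular: B_n(x) = x_n + (a polynomial in x_1, …, x_{n-1}), so it is bijective by forward
-- substitution.
--
-- For (b) take x_1 = 1 and x_j = Δʲδ(0) for j ≥ 2, where Δ is the forward difference. For 1 ≤ j ≤ p-1 the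
-- alternating sum Δʲδ(0) = Σ_i (-1)^{j-i} C(j,i) vanishes, so for n < 2p the only partitions contributing to
-- B_n(x) consist of singletons and at most one larger block, and B_n(x) = Σ_j C(n,j) Δʲδ(0) = δ_n by Newton's
-- forward difference formula. Evaluating the same alternating sum gives x_{p+k} = (-1)^{k+1} C(p-1+k, p-1), and
-- k · C(p-1+k, p-1) = p · C(p-1+k, p) ≡ p (mod p²) because C(p-1+k, p) ≡ C(k-1, k-1) = 1 (mod p).

module Submission where

open import Defs
open import Data.Nat.Base as ℕ using (ℕ; zero; suc; _≤_; _<_; z≤n; s≤s; _∸_; _!; NonZero)
import Data.Nat.Properties as ℕₚ
open import Data.Nat.DivMod using (/-congʳ; n/n≡1; m/n*n≡m; %-distribˡ-+; m≡m%n+[m/n]*n; m<n⇒m%n≡m)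
open import Data.Nat.Combinatorics using (_C_; nCk+nC[k+1]≡[n+1]C[k+1]; k>n⇒nCk≡0; nCk≡n!/k![n-k]!; k![n∸k]!∣n!; nCk≡nC[n∸k]; nCn≡1)
open import Data.Integer.Base as ℤ using (ℤ; +_; -[1+_]; -1ℤ; _+_; _*_; -_; _-_; _^_)
import Data.Integer.Properties as ℤₚ
open import Algebra.Properties.AbelianGroup ℤₚ.+-0-abelianGroup using (∙-cancelʳ)
open import Data.Integer.Tactic.RingSolver using (solve-∀)
open import Data.Nat.Tactic.RingSolver renaming (solve-∀ to ℕ-solve-∀)
open import Data.Nat.Divisibility using (_∣_; _∤_; _∣0; divides; ∣-trans; ∣⇒≤; m∣m*n; n∣m⇒m%n≡0)
open import Data.Nat.Primality using (Prime; euclidsLemma; prime⇒nonZero; prime⇒nonTrivial)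
open import Data.Nat.GCD using (gcd)
open import Data.Rational as ℚ using (ℚ; ↧ₙ_; toℚᵘ)
import Data.Rational.Properties as ℚₚ
import Data.Rational.Unnormalised as ℚᵘ
import Data.Rational.Unnormalised.Properties as ℚᵘₚ
open import Data.Sum using (inj₁; inj₂)
open import Data.List.Base as List using (List; []; _∷_; upTo; filter; concatMap; _++_)
import Data.List.Properties as Listₚ
open import Data.Vec.Base as Vec using (Vec; []; _∷_; _∷ʳ_; tabulate; lookup)
import Data.Vec.Properties as Vecₚ
open import Data.Vec.Relation.Unary.All using (All; []; _∷_)
open import Data.Fin.Base as Fin using (Fin; toℕ; fromℕ<)
import Data.Fin.Properties as Finₚ
open import Data.Bool.Base using (if_then_else_; true; false; T)
open import Data.Product using (Σ; _×_; _,_)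
open import Data.Empty using (⊥-elim)
open import Function.Base using (_∘_)
open import Function.Definitions using (Bijective)
open import Level using (0ℓ)
open import Relation.Nullary using (Dec; yes; no; does; contradiction)
open import Relation.Nullary.Decidable using (_×-dec_)
open import Relation.Unary using (Pred; Decidable)
open import Relation.Binary.PropositionalEquality
open ≡-Reasoning

infixl 10 ∑<

∑< : ℕ → (ℕ → ℤ) → ℤ
∑< zero    f = + 0
∑< (suc n) f = ∑< n f + f n

syntax ∑< n (λ i → e) = ∑[ i < n ] e

∑-cong : ∀ {f g} n → (∀ i → i < n → f i ≡ g i) → ∑< n f ≡ ∑< n g
∑-cong zero    f≡g = refl
∑-cong (suc n) f≡g = cong₂ _+_ (∑-cong n (λ i i<n → f≡g i (ℕₚ.m<n⇒m<1+n i<n))) (f≡g n ℕₚ.≤-refl)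

∑-zero : ∀ {f} n → (∀ i → i < n → f i ≡ + 0) → ∑< n f ≡ + 0
∑-zero n f≡0 = trans (∑-cong n f≡0) (∑0 n)
  where
  ∑0 : ∀ n → ∑[ _ < n ] (+ 0) ≡ + 0
  ∑0 zero    = refl
  ∑0 (suc n) = trans (ℤₚ.+-identityʳ _) (∑0 n)

∑-distrib-+ : ∀ f g n → ∑[ i < n ] (f i + g i) ≡ ∑< n f + ∑< n g
∑-distrib-+ f g zero    = refl
∑-distrib-+ f g (suc n) = trans (cong (_+ (f n + g n)) (∑-distrib-+ f g n)) (swap (∑< n f) (∑< n g) (f n) (g n))
  where
  swap : ∀ a b c d → (a + b) + (c + d) ≡ (a + c) + (b + d)
  swap = solve-∀

∑-neg : ∀ f n → ∑[ i < n ] (- f i) ≡ - ∑< n f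
∑-neg f zero    = refl
∑-neg f (suc n) = trans (cong (_+ - f n) (∑-neg f n)) (sym (ℤₚ.neg-distrib-+ (∑< n f) (f n)))

∑-head : ∀ f n → ∑< (suc n) f ≡ f 0 + ∑[ i < n ] f (suc i)
∑-head f zero    = ℤₚ.+-comm (+ 0) (f 0)
∑-head f (suc n) = begin
  ∑< (suc n) f + f (suc n)                      ≡⟨ cong (_+ f (suc n)) (∑-head f n) ⟩
  (f 0 + ∑[ i < n ] f (suc i)) + f (suc n)      ≡⟨ ℤₚ.+-assoc (f 0) _ _ ⟩
  f 0 + (∑[ i < n ] f (suc i) + f (suc n))      ∎

∑-reverse : ∀ f n → ∑< n f ≡ ∑[ i < n ] f (n ∸ suc i)
∑-reverse f zero    = refl
∑-reverse f (suc n) = begin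
  ∑< n f + f n                                  ≡⟨ cong (_+ f n) (∑-reverse f n) ⟩
  ∑[ i < n ] f (n ∸ suc i) + f n                ≡⟨ ℤₚ.+-comm _ (f n) ⟩
  f n + ∑[ i < n ] f (n ∸ suc i)                ≡⟨ ∑-head (λ i → f (suc n ∸ suc i)) n ⟨
  ∑[ i < suc n ] f (suc n ∸ suc i)              ∎

∑-single : ∀ f n t → t < n → (∀ i → i < n → i ≢ t → f i ≡ + 0) → ∑< n f ≡ f t
∑-single f (suc n) t t<1+n others≡0 with t ℕₚ.≟ n
... | yes refl = trans (cong (_+ f t) (∑-zero t (λ i i<t → others≡0 i (ℕₚ.m<n⇒m<1+n i<t) (ℕₚ.<⇒≢ i<t))))
                       (ℤₚ.+-identityˡ (f t))
... | no  t≢n  = trans (cong₂ _+_ (∑-single f n t (ℕₚ.≤∧≢⇒< (ℕₚ.≤-pred t<1+n) t≢n)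
                                               (λ i i<n → others≡0 i (ℕₚ.m<n⇒m<1+n i<n)))
                                  (others≡0 n ℕₚ.≤-refl (t≢n ∘ sym)))
                       (ℤₚ.+-identityʳ (f t))

∑-truncate : ∀ f q n → q ≤ n → (∀ i → q < i → i ≤ n → f i ≡ + 0) → ∑< (suc n) f ≡ ∑< (suc q) f
∑-truncate f q zero    z≤n _    = refl
∑-truncate f q (suc n) q≤1+n tail≡0 with q ℕₚ.≟ suc n
... | yes refl = refl
... | no  q≢1+n = trans (cong₂ _+_ (∑-truncate f q n q≤n (λ i q<i i≤n → tail≡0 i q<i (ℕₚ.m≤n⇒m≤1+n i≤n)))
                                   (tail≡0 (suc n) (s≤s q≤n) ℕₚ.≤-refl))
                        (ℤₚ.+-identityʳ _)
  where q≤n = ℕₚ.≤-pred (ℕₚ.≤∧≢⇒< q≤1+n q≢1+n)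

sumℤ-applyUpTo : ∀ f n → sumℤ (List.applyUpTo f n) ≡ ∑< n f
sumℤ-applyUpTo f zero    = refl
sumℤ-applyUpTo f (suc n) = trans (cong (λ s → f 0 + s) (sumℤ-applyUpTo (f ∘ suc) n)) (sym (∑-head f n))

sumℤ-upTo : ∀ f n → sumℤ (List.map f (upTo n)) ≡ ∑< n f
sumℤ-upTo f n = trans (cong sumℤ (Listₚ.map-upTo f n)) (sumℤ-applyUpTo f n)

sumℤ-++ : ∀ xs ys → sumℤ (xs ++ ys) ≡ sumℤ xs + sumℤ ys
sumℤ-++ []       ys = sym (ℤₚ.+-identityˡ _)
sumℤ-++ (x ∷ xs) ys = trans (cong (λ s → x + s) (sumℤ-++ xs ys)) (sym (ℤₚ.+-assoc x _ _))

sumℤ-map-≡0 : ∀ {A : Set} {f : A → ℤ} xs → (∀ x → f x ≡ + 0) → sumℤ (List.map f xs) ≡ + 0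
sumℤ-map-≡0 []       f≡0 = refl
sumℤ-map-≡0 (x ∷ xs) f≡0 = cong₂ _+_ (f≡0 x) (sumℤ-map-≡0 xs f≡0)

sumℤ-concatMap : ∀ {A B : Set} (f : B → ℤ) (g : A → List B) xs →
                 sumℤ (List.map f (concatMap g xs)) ≡ sumℤ (List.map (λ x → sumℤ (List.map f (g x))) xs)
sumℤ-concatMap f g []       = refl
sumℤ-concatMap f g (x ∷ xs) = begin
  sumℤ (List.map f (g x ++ concatMap g xs))                   ≡⟨ cong sumℤ (Listₚ.map-++ f (g x) (concatMap g xs)) ⟩
  sumℤ (List.map f (g x) ++ List.map f (concatMap g xs))      ≡⟨ sumℤ-++ (List.map f (g x)) _ ⟩
  sumℤ (List.map f (g x)) + sumℤ (List.map f (concatMap g xs)) ≡⟨ cong (λ s → sumℤ (List.map f (g x)) + s) (sumℤ-concatMap f g xs) ⟩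
  sumℤ (List.map f (g x)) + sumℤ (List.map (λ y → sumℤ (List.map f (g y))) xs) ∎

sumℤ-filter : ∀ {A : Set} {P : Pred A 0ℓ} (P? : Decidable P) (f : A → ℤ) xs →
              sumℤ (List.map f (filter P? xs)) ≡ sumℤ (List.map (λ x → if does (P? x) then f x else + 0) xs)
sumℤ-filter P? f []       = refl
sumℤ-filter P? f (x ∷ xs) with does (P? x)
... | true  = cong (λ s → f x + s) (sumℤ-filter P? f xs)
... | false = trans (sumℤ-filter P? f xs) (sym (ℤₚ.+-identityˡ _))

sumℤ-tuples-single : ∀ m b (f : Vec ℕ m → ℤ) t → All (_≤ b) t → (∀ js → js ≢ t → f js ≡ + 0) →
                     sumℤ (List.map f (tuples m b)) ≡ f t
sumℤ-tuples-single zero    b f [] [] _ = ℤₚ.+-identityʳ (f [])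
sumℤ-tuples-single (suc m) b f (t ∷ ts) (t≤b ∷ ts≤b) others≡0 = begin
  sumℤ (List.map f (concatMap (λ j → List.map (j ∷_) (tuples m b)) (upTo (suc b))))
    ≡⟨ sumℤ-concatMap f (λ j → List.map (j ∷_) (tuples m b)) (upTo (suc b)) ⟩
  sumℤ (List.map (λ j → sumℤ (List.map f (List.map (j ∷_) (tuples m b)))) (upTo (suc b)))
    ≡⟨ sumℤ-upTo _ (suc b) ⟩
  ∑[ j < suc b ] sumℤ (List.map f (List.map (j ∷_) (tuples m b)))
    ≡⟨ ∑-single _ (suc b) t (s≤s t≤b) other-heads ⟩
  sumℤ (List.map f (List.map (t ∷_) (tuples m b)))
    ≡⟨ cong sumℤ (Listₚ.map-∘ (tuples m b)) ⟨
  sumℤ (List.map (f ∘ (t ∷_)) (tuples m b))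
    ≡⟨ sumℤ-tuples-single m b (f ∘ (t ∷_)) ts ts≤b (λ js js≢ts → others≡0 (t ∷ js) (js≢ts ∘ cong Vec.tail)) ⟩
  f (t ∷ ts) ∎
  where
  other-heads : ∀ j → j < suc b → j ≢ t → sumℤ (List.map f (List.map (j ∷_) (tuples m b))) ≡ + 0
  other-heads j _ j≢t = trans (cong sumℤ (sym (Listₚ.map-∘ (tuples m b))))
                              (sumℤ-map-≡0 (tuples m b) (λ js → others≡0 (j ∷ js) (j≢t ∘ cong Vec.head)))

sumℤ-filter-tuples-single : ∀ {m b} {P : Pred (Vec ℕ m) 0ℓ} (P? : Decidable P) (f : Vec ℕ m → ℤ) t →
                            All (_≤ b) t → P t → (∀ js → P js → js ≢ t → f js ≡ + 0) →
                            sumℤ (List.map f (filter P? (tuples m b))) ≡ f t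
sumℤ-filter-tuples-single {m} {b} {P} P? f t t≤b Pt others≡0 =
  trans (sumℤ-filter P? f (tuples m b)) (trans (sumℤ-tuples-single m b _ t t≤b filtered≡0) (kept (P? t)))
  where
  filtered≡0 : ∀ js → js ≢ t → (if does (P? js) then f js else + 0) ≡ + 0
  filtered≡0 js js≢t with P? js
  ... | yes Pjs = others≡0 js Pjs js≢t
  ... | no  _   = refl
  kept : (d : Dec (P t)) → (if does d then f t else + 0) ≡ f t
  kept (yes _)  = refl
  kept (no ¬Pt) = ⊥-elim (¬Pt Pt)

singleBlock : ∀ m → Vec ℕ (suc m)
singleBlock zero    = 1 ∷ []
singleBlock (suc m) = 0 ∷ singleBlock m

sum-singleBlock : ∀ m → Vec.sum (singleBlock m) ≡ 1
sum-singleBlock zero    = refl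
sum-singleBlock (suc m) = sum-singleBlock m

wsum-singleBlock : ∀ s m → wsum s (singleBlock m) ≡ s ℕ.+ m
wsum-singleBlock s zero    = trans (ℕₚ.+-identityʳ (s ℕ.* 1)) (trans (ℕₚ.*-identityʳ s) (sym (ℕₚ.+-identityʳ s)))
wsum-singleBlock s (suc m) = trans (cong (ℕ._+ wsum (suc s) (singleBlock m)) (ℕₚ.*-zeroʳ s))
                                   (trans (wsum-singleBlock (suc s) m) (sym (ℕₚ.+-suc s m)))

denom-singleBlock : ∀ s m → denom s (singleBlock m) ≡ (s ℕ.+ m) !
denom-singleBlock s zero    = trans (ℕₚ.*-identityʳ _) (trans (ℕₚ.+-identityʳ _)
                                (trans (ℕₚ.*-identityʳ (s !)) (cong _! (sym (ℕₚ.+-identityʳ s)))))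
denom-singleBlock s (suc m) = trans (ℕₚ.+-identityʳ _) (trans (denom-singleBlock (suc s) m) (cong _! (sym (ℕₚ.+-suc s m))))

mono-singleBlock : ∀ x s m → mono x s (singleBlock m) ≡ x (s ℕ.+ m)
mono-singleBlock x s zero    = trans (ℤₚ.*-identityʳ _) (trans (ℤₚ.*-identityʳ (x s)) (cong x (sym (ℕₚ.+-identityʳ s))))
mono-singleBlock x s (suc m) = trans (ℤₚ.*-identityˡ _) (trans (mono-singleBlock x (suc s) m) (cong x (sym (ℕₚ.+-suc s m))))

coeff-singleBlock : ∀ m → coeff (suc m) (singleBlock m) ≡ 1
coeff-singleBlock m = trans (/-congʳ {{denom≢0 1 (singleBlock m)}} {{suc m !≢0}} (denom-singleBlock 1 m))
                            (n/n≡1 (suc m !) {{suc m !≢0}})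
  where open ℕₚ using (_!≢0)

coeff-twoSizes : ∀ k d → coeff (k ℕ.+ suc (suc d)) (k ∷ singleBlock d) ≡ (k ℕ.+ suc (suc d)) C suc (suc d)
coeff-twoSizes k d = begin
  coeff n (k ∷ singleBlock d)
    ≡⟨ /-congʳ {{denom≢0 1 (k ∷ singleBlock d)}} {{suc (suc d) !* (n ∸ suc (suc d)) !≢0}} denom≡ ⟩
  (n ! ℕ./ (suc (suc d) ! ℕ.* (n ∸ suc (suc d)) !)) {{suc (suc d) !* (n ∸ suc (suc d)) !≢0}}
    ≡⟨ nCk≡n!/k![n-k]! (ℕₚ.m≤n+m (suc (suc d)) k) ⟨
  n C suc (suc d) ∎
  where
  open ℕₚ using (_!*_!≢0)
  n = k ℕ.+ suc (suc d)
  denom≡ : denom 1 (k ∷ singleBlock d) ≡ suc (suc d) ! ℕ.* (n ∸ suc (suc d)) !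
  denom≡ = begin
    (k ! ℕ.* (1 !) ℕ.^ k) ℕ.* denom 2 (singleBlock d)  ≡⟨ cong₂ (λ u v → (k ! ℕ.* u) ℕ.* v) (ℕₚ.^-zeroˡ k) (denom-singleBlock 2 d) ⟩
    (k ! ℕ.* 1) ℕ.* suc (suc d) !                      ≡⟨ cong (ℕ._* suc (suc d) !) (ℕₚ.*-identityʳ (k !)) ⟩
    k ! ℕ.* suc (suc d) !                              ≡⟨ ℕₚ.*-comm (k !) _ ⟩
    suc (suc d) ! ℕ.* k !                              ≡⟨ cong (λ i → suc (suc d) ! ℕ.* i !) (ℕₚ.m+n∸n≡m k (suc (suc d))) ⟨
    suc (suc d) ! ℕ.* (n ∸ suc (suc d)) !              ∎

singleBlock≤ : ∀ {b} m → 1 ≤ b → All (_≤ b) (singleBlock m)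
singleBlock≤ zero    1≤b = 1≤b ∷ []
singleBlock≤ (suc m) 1≤b = z≤n ∷ singleBlock≤ m 1≤b

sum≡0⇒wsum≡0 : ∀ {m} s (js : Vec ℕ m) → Vec.sum js ≡ 0 → wsum s js ≡ 0
sum≡0⇒wsum≡0 s []            _   = refl
sum≡0⇒wsum≡0 s (zero ∷ js)   sum≡0 = trans (cong (ℕ._+ wsum (suc s) js) (ℕₚ.*-zeroʳ s)) (sum≡0⇒wsum≡0 (suc s) js sum≡0)

sum≡1⇒singleBlock : ∀ {m} s (js : Vec ℕ (suc m)) → Vec.sum js ≡ 1 → wsum s js ≡ s ℕ.+ m → js ≡ singleBlock m
sum≡1⇒singleBlock {zero}  s (1 ∷ [])           _     _    = refl
sum≡1⇒singleBlock {suc m} s (zero ∷ js)        sum≡1 wsum≡ = cong (0 ∷_) (sum≡1⇒singleBlock (suc s) js sum≡1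
  (trans (sym (cong (ℕ._+ wsum (suc s) js) (ℕₚ.*-zeroʳ s))) (trans wsum≡ (ℕₚ.+-suc s m))))
sum≡1⇒singleBlock {suc m} s (suc zero ∷ js)    sum≡1 wsum≡ = ⊥-elim (ℕₚ.m≢1+m+n s (begin
  s                       ≡⟨ ℕₚ.+-identityʳ s ⟨
  s ℕ.+ 0                 ≡⟨ cong₂ ℕ._+_ (ℕₚ.*-identityʳ s) (sum≡0⇒wsum≡0 (suc s) js (ℕₚ.suc-injective sum≡1)) ⟨
  s ℕ.* 1 ℕ.+ wsum (suc s) js ≡⟨ wsum≡ ⟩
  s ℕ.+ suc m             ≡⟨ ℕₚ.+-suc s m ⟩
  suc (s ℕ.+ m)           ∎))

mono-local : ∀ {m} x y s (js : Vec ℕ m) → (∀ i → s ≤ i → i < s ℕ.+ m → x i ≡ y i) → mono x s js ≡ mono y s js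
mono-local x y s []                x≡y = refl
mono-local {suc m} x y s (j ∷ js) x≡y =
  cong₂ _*_ (cong (_^ j) (x≡y s ℕₚ.≤-refl (ℕₚ.m<m+n s (s≤s z≤n))))
            (mono-local x y (suc s) js (λ i 1+s≤i i<1+s+m →
              x≡y i (ℕₚ.≤-trans (ℕₚ.n≤1+n s) 1+s≤i) (ℕₚ.≤-trans i<1+s+m (ℕₚ.≤-reflexive (sym (ℕₚ.+-suc s m))))))

IsMultiIndex : ∀ {ℓ} (n k : ℕ) → Pred (Vec ℕ ℓ) 0ℓ
IsMultiIndex n k js = Vec.sum js ≡ k × wsum 1 js ≡ n

isMultiIndex? : ∀ {ℓ} n k → Decidable (IsMultiIndex {ℓ} n k)
isMultiIndex? n k js = (Vec.sum js ℕₚ.≟ k) ×-dec (wsum 1 js ℕₚ.≟ n)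

bellTerm : ∀ {ℓ} → ℕ → (ℕ → ℤ) → Vec ℕ ℓ → ℤ
bellTerm n x js = + coeff n js * mono x 1 js

-- partialBell with the length ℓ of its multi-indices freed from suc (n ∸ k), so that it can be rewritten.
partialBellOver : ℕ → ℕ → ℕ → (ℕ → ℤ) → ℤ
partialBellOver ℓ n k x = sumℤ (List.map (bellTerm n x) (filter (isMultiIndex? n k) (tuples ℓ k)))

partialBell≡partialBellOver : ∀ {ℓ} n k x → suc (n ∸ k) ≡ ℓ → partialBell n k x ≡ partialBellOver ℓ n k x
partialBell≡partialBellOver n k x refl = refl

partialBell-local : ∀ n k x y → (∀ i → 1 ≤ i → i ≤ suc (n ∸ k) → x i ≡ y i) → partialBell n k x ≡ partialBell n k y
partialBell-local n k x y x≡y = cong sumℤ (Listₚ.map-cong (λ js → cong (+ coeff n js *_)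
  (mono-local x y 1 js (λ i 1≤i i< → x≡y i 1≤i (ℕₚ.≤-pred i<)))) (filter (isMultiIndex? n k) (tuples (suc (n ∸ k)) k)))

partialBell-linear : ∀ m x → partialBell (suc m) 1 x ≡ x (suc m)
partialBell-linear m x = begin
  partialBell (suc m) 1 x
    ≡⟨ sumℤ-filter-tuples-single (isMultiIndex? (suc m) 1) (bellTerm (suc m) x) (singleBlock m) (singleBlock≤ m ℕₚ.≤-refl)
         (sum-singleBlock m , wsum-singleBlock 1 m)
         (λ js (sum≡1 , wsum≡) js≢ → ⊥-elim (js≢ (sum≡1⇒singleBlock 1 js sum≡1 wsum≡))) ⟩
  + coeff (suc m) (singleBlock m) * mono x 1 (singleBlock m)
    ≡⟨ cong₂ (λ c v → + c * v) (coeff-singleBlock m) (mono-singleBlock x 1 m) ⟩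
  + 1 * x (suc m)
    ≡⟨ ℤₚ.*-identityˡ _ ⟩
  x (suc m) ∎

nonlinearBell : ℕ → (ℕ → ℤ) → ℤ
nonlinearBell m x = ∑[ k < m ] partialBell (suc m) (suc (suc k)) x

completeBell-suc : ∀ m x → completeBell (suc m) x ≡ x (suc m) + nonlinearBell m x
completeBell-suc m x = begin
  completeBell (suc m) x                                       ≡⟨ sumℤ-upTo (λ k → partialBell (suc m) (suc k) x) (suc m) ⟩
  ∑[ k < suc m ] partialBell (suc m) (suc k) x                 ≡⟨ ∑-head (λ k → partialBell (suc m) (suc k) x) m ⟩
  partialBell (suc m) 1 x + nonlinearBell m x                  ≡⟨ cong (_+ nonlinearBell m x) (partialBell-linear m x) ⟩
  x (suc m) + nonlinearBell m x                                ∎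

nonlinearBell-local : ∀ m x y → (∀ i → 1 ≤ i → i ≤ m → x i ≡ y i) → nonlinearBell m x ≡ nonlinearBell m y
nonlinearBell-local m x y x≡y = ∑-cong m (λ k k<m → partialBell-local (suc m) (suc (suc k)) x y
  (λ i 1≤i i≤ → x≡y i 1≤i (ℕₚ.≤-trans i≤ (length≤m k k<m))))
  where
  length≤m : ∀ k → k < m → suc (suc m ∸ suc (suc k)) ≤ m
  length≤m k k<m = ℕₚ.≤-trans (ℕₚ.≤-reflexive (sym (ℕₚ.+-∸-assoc 1 k<m))) (ℕₚ.m∸n≤m m k)

completeBell-local : ∀ n x y → (∀ i → 1 ≤ i → i ≤ n → x i ≡ y i) → completeBell n x ≡ completeBell n y
completeBell-local zero    x y _   = refl
completeBell-local (suc m) x y x≡y = begin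
  completeBell (suc m) x            ≡⟨ completeBell-suc m x ⟩
  x (suc m) + nonlinearBell m x     ≡⟨ cong₂ _+_ (x≡y (suc m) (s≤s z≤n) ℕₚ.≤-refl)
                                                 (nonlinearBell-local m x y (λ i 1≤i i≤m → x≡y i 1≤i (ℕₚ.m≤n⇒m≤1+n i≤m))) ⟩
  y (suc m) + nonlinearBell m y     ≡⟨ completeBell-suc m y ⟨
  completeBell (suc m) y            ∎

entry-ext : ∀ {n} (xs ys : Vec ℤ n) → (∀ i → 1 ≤ i → i ≤ n → entry xs i ≡ entry ys i) → xs ≡ ys
entry-ext []       []       _     = refl
entry-ext (x ∷ xs) (y ∷ ys) xs≡ys = cong₂ _∷_ (xs≡ys 1 (s≤s z≤n) (s≤s z≤n))
  (entry-ext xs ys (λ { (suc i) _ i<n → xs≡ys (suc (suc i)) (s≤s z≤n) (s≤s i<n) }))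

lookup≡entry : ∀ {n} (xs : Vec ℤ n) (j : Fin n) → lookup xs j ≡ entry xs (suc (toℕ j))
lookup≡entry (x ∷ xs) Fin.zero    = refl
lookup≡entry (x ∷ xs) (Fin.suc j) = lookup≡entry xs j

entry-tabulate : ∀ {n} (f : ℕ → ℤ) i → 1 ≤ i → i ≤ n → entry (tabulate {n = n} (λ j → f (suc (toℕ j)))) i ≡ f i
entry-tabulate {suc n} f 1             _ _           = refl
entry-tabulate {suc n} f (suc (suc i)) _ (s≤s i<n)   = entry-tabulate (f ∘ suc) (suc i) (s≤s z≤n) i<n

entry-∷ʳ-< : ∀ {m} (xs : Vec ℤ m) x i → i ≤ m → entry (xs ∷ʳ x) i ≡ entry xs i
entry-∷ʳ-< []       x zero          _         = refl
entry-∷ʳ-< (_ ∷ xs) x zero          _         = refl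
entry-∷ʳ-< (_ ∷ xs) x 1             _         = refl
entry-∷ʳ-< (_ ∷ xs) x (suc (suc i)) (s≤s i<m) = entry-∷ʳ-< xs x (suc i) i<m

entry-∷ʳ-last : ∀ {m} (xs : Vec ℤ m) x → entry (xs ∷ʳ x) (suc m) ≡ x
entry-∷ʳ-last []       x = refl
entry-∷ʳ-last (_ ∷ xs) x = entry-∷ʳ-last xs x

lookup-𝔹 : ∀ n (xs : Vec ℤ n) m (m<n : m < n) → lookup (𝔹 n xs) (fromℕ< m<n) ≡ completeBell (suc m) (entry xs)
lookup-𝔹 n xs m m<n = trans (Vecₚ.lookup∘tabulate _ (fromℕ< m<n))
                            (cong (λ i → completeBell (suc i) (entry xs)) (Finₚ.toℕ-fromℕ< m<n))

𝔹-injective : ∀ n (xs ys : Vec ℤ n) → 𝔹 n xs ≡ 𝔹 n ys → xs ≡ ys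
𝔹-injective n xs ys 𝔹xs≡𝔹ys = entry-ext xs ys (agree n ℕₚ.≤-refl)
  where
  same-Bell : ∀ m → m < n → completeBell (suc m) (entry xs) ≡ completeBell (suc m) (entry ys)
  same-Bell m m<n = trans (sym (lookup-𝔹 n xs m m<n))
                          (trans (cong (λ v → lookup v (fromℕ< m<n)) 𝔹xs≡𝔹ys) (lookup-𝔹 n ys m m<n))
  agree : ∀ m → m ≤ n → ∀ i → 1 ≤ i → i ≤ m → entry xs i ≡ entry ys i
  agree zero    _   (suc i) _ ()
  agree (suc m) m<n i 1≤i i≤1+m with i ℕₚ.≟ suc m
  ... | no  i≢1+m = agree m (ℕₚ.<⇒≤ m<n) i 1≤i (ℕₚ.≤-pred (ℕₚ.≤∧≢⇒< i≤1+m i≢1+m))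
  ... | yes refl  = ∙-cancelʳ (nonlinearBell m (entry xs)) _ _ (begin
    entry xs (suc m) + nonlinearBell m (entry xs) ≡⟨ completeBell-suc m (entry xs) ⟨
    completeBell (suc m) (entry xs)               ≡⟨ same-Bell m m<n ⟩
    completeBell (suc m) (entry ys)               ≡⟨ completeBell-suc m (entry ys) ⟩
    entry ys (suc m) + nonlinearBell m (entry ys) ≡⟨ cong (_+_ (entry ys (suc m)))
                                                       (nonlinearBell-local m _ _ (agree m (ℕₚ.<⇒≤ m<n))) ⟨
    entry ys (suc m) + nonlinearBell m (entry xs) ∎)

𝔹-preimage : (ℕ → ℤ) → (n : ℕ) → Vec ℤ n
𝔹-preimage t zero    = []
𝔹-preimage t (suc m) = 𝔹-preimage t m ∷ʳ (t (suc m) - nonlinearBell m (entry (𝔹-preimage t m)))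

𝔹-preimage-prefix : ∀ t d m i → i ≤ m → entry (𝔹-preimage t (d ℕ.+ m)) i ≡ entry (𝔹-preimage t m) i
𝔹-preimage-prefix t zero    m i i≤m = refl
𝔹-preimage-prefix t (suc d) m i i≤m =
  trans (entry-∷ʳ-< (𝔹-preimage t (d ℕ.+ m)) _ i (ℕₚ.≤-trans i≤m (ℕₚ.m≤n+m m d))) (𝔹-preimage-prefix t d m i i≤m)

completeBell-𝔹-preimage : ∀ t n m → m < n → completeBell (suc m) (entry (𝔹-preimage t n)) ≡ t (suc m)
completeBell-𝔹-preimage t n m m<n rewrite sym (ℕₚ.m∸n+n≡m m<n) = begin
  completeBell (suc m) x                                   ≡⟨ completeBell-suc m x ⟩
  x (suc m) + nonlinearBell m x                            ≡⟨ cong₂ _+_ last-entry (nonlinearBell-local m _ _ earlier-entries) ⟩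
  (t (suc m) - nonlinearBell m x′) + nonlinearBell m x′     ≡⟨ minus-plus (t (suc m)) _ ⟩
  t (suc m)                                                ∎
  where
  d = n ∸ suc m
  x = entry (𝔹-preimage t (d ℕ.+ suc m))
  x′ = entry (𝔹-preimage t m)
  last-entry : x (suc m) ≡ t (suc m) - nonlinearBell m x′
  last-entry = trans (𝔹-preimage-prefix t d (suc m) (suc m) ℕₚ.≤-refl) (entry-∷ʳ-last (𝔹-preimage t m) _)
  earlier-entries : ∀ i → 1 ≤ i → i ≤ m → x i ≡ x′ i
  earlier-entries i _ i≤m = trans (𝔹-preimage-prefix t d (suc m) i (ℕₚ.m≤n⇒m≤1+n i≤m))
                                  (entry-∷ʳ-< (𝔹-preimage t m) _ i i≤m)
  minus-plus : ∀ a b → (a - b) + b ≡ a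
  minus-plus = solve-∀

𝔹-surjective : ∀ n (ys : Vec ℤ n) → 𝔹 n (𝔹-preimage (entry ys) n) ≡ ys
𝔹-surjective n ys = trans (Vecₚ.tabulate-cong (λ j → trans (completeBell-𝔹-preimage (entry ys) n (toℕ j) (Finₚ.toℕ<n j))
                                                           (sym (lookup≡entry ys j))))
                          (Vecₚ.tabulate∘lookup ys)

𝔹-bijective : ∀ n → Bijective _≡_ _≡_ (𝔹 n)
𝔹-bijective n = 𝔹-injective n _ _ , λ ys → 𝔹-preimage (entry ys) n , λ xs≡ → trans (cong (𝔹 n) xs≡) (𝔹-surjective n ys)

infix 8 _Cℤ_

_Cℤ_ : ℕ → ℕ → ℤ
n Cℤ k = + (n C k)

Cℤ-pascal : ∀ n k → suc n Cℤ suc k ≡ n Cℤ k + n Cℤ suc k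
Cℤ-pascal n k = trans (cong +_ (sym (nCk+nC[k+1]≡[n+1]C[k+1] n k))) (ℤₚ.pos-+ (n C k) (n C suc k))

Cℤ-above : ∀ {n k} → n < k → n Cℤ k ≡ + 0
Cℤ-above n<k = cong +_ (k>n⇒nCk≡0 n<k)

-1^n*-1^n≡1 : ∀ n → -1ℤ ^ n * -1ℤ ^ n ≡ + 1
-1^n*-1^n≡1 zero    = refl
-1^n*-1^n≡1 (suc n) = trans (square-neg (-1ℤ ^ n)) (-1^n*-1^n≡1 n)
  where
  square-neg : ∀ a → (-1ℤ * a) * (-1ℤ * a) ≡ a * a
  square-neg = solve-∀

∑-pascal : ∀ (f : ℕ → ℤ) n →
           ∑[ i < suc (suc n) ] (suc n Cℤ i * f i) ≡ ∑[ i < suc n ] (n Cℤ i * f i) + ∑[ i < suc n ] (n Cℤ i * f (suc i))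
∑-pascal f n = begin
  ∑[ i < suc (suc n) ] (suc n Cℤ i * f i)
    ≡⟨ ∑-head (λ i → suc n Cℤ i * f i) (suc n) ⟩
  f₀ + ∑[ i < suc n ] (suc n Cℤ suc i * f (suc i))
    ≡⟨ cong (_+_ f₀) (∑-cong {f = λ i → suc n Cℤ suc i * f (suc i)} (suc n) (λ i _ → split i)) ⟩
  f₀ + ∑[ i < suc n ] (n Cℤ i * f (suc i) + n Cℤ suc i * f (suc i))
    ≡⟨ cong (_+_ f₀) (∑-distrib-+ (λ i → n Cℤ i * f (suc i)) upper (suc n)) ⟩
  f₀ + (A + (∑< n upper + upper n))
    ≡⟨ cong (λ t → f₀ + (A + (∑< n upper + t))) (cong (_* f (suc n)) (Cℤ-above (ℕₚ.n<1+n n))) ⟩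
  f₀ + (A + (∑< n upper + + 0))
    ≡⟨ regroup f₀ A (∑< n upper) ⟩
  (f₀ + ∑< n upper) + A
    ≡⟨ cong (_+ A) (∑-head (λ i → n Cℤ i * f i) n) ⟨
  ∑[ i < suc n ] (n Cℤ i * f i) + A
    ∎
  where
  f₀ = suc n Cℤ 0 * f 0
  upper = λ i → n Cℤ suc i * f (suc i)
  A = ∑[ i < suc n ] (n Cℤ i * f (suc i))
  split : ∀ i → suc n Cℤ suc i * f (suc i) ≡ n Cℤ i * f (suc i) + n Cℤ suc i * f (suc i)
  split i = trans (cong (_* f (suc i)) (Cℤ-pascal n i)) (ℤₚ.*-distribʳ-+ (f (suc i)) (n Cℤ i) (n Cℤ suc i))
  regroup : ∀ a b c → a + (b + (c + + 0)) ≡ (a + c) + b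
  regroup = solve-∀

∑-alternating : ∀ n q → ∑[ i < suc q ] (-1ℤ ^ i * suc n Cℤ i) ≡ -1ℤ ^ q * n Cℤ q
∑-alternating n zero    = refl
∑-alternating n (suc q) = begin
  ∑[ i < suc q ] (-1ℤ ^ i * suc n Cℤ i) + -1ℤ ^ suc q * suc n Cℤ suc q
    ≡⟨ cong₂ (λ a b → a + -1ℤ ^ suc q * b) (∑-alternating n q) (Cℤ-pascal n q) ⟩
  -1ℤ ^ q * n Cℤ q + -1ℤ * -1ℤ ^ q * (n Cℤ q + n Cℤ suc q)
    ≡⟨ telescope (-1ℤ ^ q) (n Cℤ q) (n Cℤ suc q) ⟩
  -1ℤ * -1ℤ ^ q * n Cℤ suc q
    ∎
  where
  telescope : ∀ a x y → a * x + -1ℤ * a * (x + y) ≡ -1ℤ * a * y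
  telescope = solve-∀

Δ^ : ℕ → (ℕ → ℤ) → ℕ → ℤ
Δ^ zero    f n = f n
Δ^ (suc s) f n = Δ^ s f (suc n) - Δ^ s f n

Δ^-newton : ∀ f n → ∑[ i < suc n ] (n Cℤ i * Δ^ i f 0) ≡ f n
Δ^-newton f n = trans (∑-cong (suc n) (λ i _ → cong (λ s → n Cℤ i * Δ^ s f 0) (sym (ℕₚ.+-identityʳ i))))
                      (shifted n 0)
  where
  shifted : ∀ n s → ∑[ i < suc n ] (n Cℤ i * Δ^ (i ℕ.+ s) f 0) ≡ Δ^ s f n
  shifted zero    s = trans (ℤₚ.+-identityˡ _) (ℤₚ.*-identityˡ _)
  shifted (suc n) s = begin
    ∑[ i < suc (suc n) ] (suc n Cℤ i * Δ^ (i ℕ.+ s) f 0)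
      ≡⟨ ∑-pascal (λ i → Δ^ (i ℕ.+ s) f 0) n ⟩
    ∑[ i < suc n ] (n Cℤ i * Δ^ (i ℕ.+ s) f 0) + ∑[ i < suc n ] (n Cℤ i * Δ^ (suc i ℕ.+ s) f 0)
      ≡⟨ cong₂ _+_ (shifted n s) (trans (∑-cong (suc n) (λ i _ → cong (λ t → n Cℤ i * Δ^ t f 0) (sym (ℕₚ.+-suc i s))))
                                        (shifted n (suc s))) ⟩
    Δ^ s f n + (Δ^ s f (suc n) - Δ^ s f n)
      ≡⟨ plus-minus (Δ^ s f n) (Δ^ s f (suc n)) ⟩
    Δ^ s f (suc n)
      ∎
    where
    plus-minus : ∀ a b → a + (b - a) ≡ b
    plus-minus = solve-∀

Δ^-closedForm : ∀ s (f : ℕ → ℤ) n → Δ^ s f n ≡ -1ℤ ^ s * ∑[ i < suc s ] (s Cℤ i * (-1ℤ ^ i * f (n ℕ.+ i)))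
Δ^-closedForm zero    f n = trans (cong f (sym (ℕₚ.+-identityʳ n))) (units (f (n ℕ.+ 0)))
  where
  units : ∀ a → a ≡ + 1 * (+ 0 + + 1 * (+ 1 * a))
  units = solve-∀
Δ^-closedForm (suc s) f n = begin
  Δ^ s f (suc n) - Δ^ s f n
    ≡⟨ cong₂ _-_ (Δ^-closedForm s f (suc n)) (Δ^-closedForm s f n) ⟩
  -1ℤ ^ s * B - -1ℤ ^ s * A
    ≡⟨ flip-sign (-1ℤ ^ s) A B ⟩
  -1ℤ * -1ℤ ^ s * (A + - B)
    ≡⟨ cong (λ t → -1ℤ * -1ℤ ^ s * (A + t)) shifted-sum ⟨
  -1ℤ * -1ℤ ^ s * (∑[ i < suc s ] (s Cℤ i * g i) + ∑[ i < suc s ] (s Cℤ i * g (suc i)))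
    ≡⟨ cong (-1ℤ * -1ℤ ^ s *_) (∑-pascal g s) ⟨
  -1ℤ ^ suc s * ∑[ i < suc (suc s) ] (suc s Cℤ i * g i)
    ∎
  where
  g : ℕ → ℤ
  g i = -1ℤ ^ i * f (n ℕ.+ i)
  A = ∑[ i < suc s ] (s Cℤ i * g i)
  B = ∑[ i < suc s ] (s Cℤ i * (-1ℤ ^ i * f (suc n ℕ.+ i)))
  flip-sign : ∀ σ a b → σ * b - σ * a ≡ -1ℤ * σ * (a + - b)
  flip-sign = solve-∀
  negate : ∀ c σ a → c * (-1ℤ * σ * a) ≡ - (c * (σ * a))
  negate = solve-∀
  shifted-sum : ∑[ i < suc s ] (s Cℤ i * g (suc i)) ≡ - B
  shifted-sum = trans (∑-cong {f = λ i → s Cℤ i * g (suc i)} (suc s) (λ i _ →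
                  trans (cong (λ m → s Cℤ i * (-1ℤ * -1ℤ ^ i * f m)) (ℕₚ.+-suc n i)) (negate (s Cℤ i) (-1ℤ ^ i) _)))
                  (∑-neg (λ i → s Cℤ i * (-1ℤ ^ i * f (suc n ℕ.+ i))) (suc s))

δ≡1 : ∀ p j → j ≤ p ∸ 1 → δ p j ≡ + 1
δ≡1 p j j≤ with j ℕ.≤ᵇ p ∸ 1 | ℕₚ.≤⇒≤ᵇ j≤
... | true | _ = refl

δ≡0 : ∀ p j → p ∸ 1 < j → δ p j ≡ + 0
δ≡0 p j j> with j ℕ.≤ᵇ p ∸ 1 in j≤ᵇ
... | false = refl
... | true  = ⊥-elim (ℕₚ.<⇒≱ j> (ℕₚ.≤ᵇ⇒≤ j (p ∸ 1) (subst T (sym j≤ᵇ) _)))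

∑-δ≡1 : ∀ p L q → q ≤ p ∸ 1 → ∑[ i < suc q ] (L Cℤ i * (-1ℤ ^ i * δ p i)) ≡ ∑[ i < suc q ] (-1ℤ ^ i * L Cℤ i)
∑-δ≡1 p L q q≤ = ∑-cong (suc q) λ i i≤q →
  trans (cong (λ d → L Cℤ i * (-1ℤ ^ i * d)) (δ≡1 p i (ℕₚ.≤-trans (ℕₚ.≤-pred i≤q) q≤))) (drop-one (L Cℤ i) (-1ℤ ^ i))
  where
  drop-one : ∀ c σ → c * (σ * + 1) ≡ σ * c
  drop-one = solve-∀

Δ^δ-small : ∀ p L → 1 ≤ L → L ≤ p ∸ 1 → Δ^ L (δ p) 0 ≡ + 0
Δ^δ-small p L@(suc n) _ L≤ = begin
  Δ^ L (δ p) 0                                          ≡⟨ Δ^-closedForm L (δ p) 0 ⟩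
  -1ℤ ^ L * ∑[ i < suc L ] (L Cℤ i * (-1ℤ ^ i * δ p i)) ≡⟨ cong (-1ℤ ^ L *_) (∑-δ≡1 p L L L≤) ⟩
  -1ℤ ^ L * ∑[ i < suc L ] (-1ℤ ^ i * suc n Cℤ i)       ≡⟨ cong (-1ℤ ^ L *_) (∑-alternating n L) ⟩
  -1ℤ ^ L * (-1ℤ ^ L * n Cℤ L)                          ≡⟨ cong (λ c → -1ℤ ^ L * (-1ℤ ^ L * c)) (Cℤ-above (ℕₚ.n<1+n n)) ⟩
  -1ℤ ^ L * (-1ℤ ^ L * + 0)                             ≡⟨ cong (-1ℤ ^ L *_) (ℤₚ.*-zeroʳ (-1ℤ ^ L)) ⟩
  -1ℤ ^ L * + 0                                         ≡⟨ ℤₚ.*-zeroʳ (-1ℤ ^ L) ⟩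
  + 0                                                   ∎

Δ^δ-large : ∀ q k → Δ^ (suc q ℕ.+ k) (δ (suc q)) 0 ≡ -1ℤ ^ suc k * (q ℕ.+ k) Cℤ q
Δ^δ-large q k = begin
  Δ^ L (δ p) 0                                          ≡⟨ Δ^-closedForm L (δ p) 0 ⟩
  -1ℤ ^ L * ∑[ i < suc L ] (L Cℤ i * (-1ℤ ^ i * δ p i)) ≡⟨ cong (-1ℤ ^ L *_) (∑-truncate _ q L q≤L vanishing) ⟩
  -1ℤ ^ L * ∑[ i < suc q ] (L Cℤ i * (-1ℤ ^ i * δ p i)) ≡⟨ cong (-1ℤ ^ L *_) (∑-δ≡1 p L q ℕₚ.≤-refl) ⟩
  -1ℤ ^ L * ∑[ i < suc q ] (-1ℤ ^ i * L Cℤ i)           ≡⟨ cong (-1ℤ ^ L *_) (∑-alternating (q ℕ.+ k) q) ⟩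
  -1ℤ ^ L * (-1ℤ ^ q * binom)                           ≡⟨ cong (λ σ → -1ℤ * σ * (-1ℤ ^ q * binom)) (ℤₚ.^-distribˡ-+-* -1ℤ q k) ⟩
  -1ℤ * (-1ℤ ^ q * -1ℤ ^ k) * (-1ℤ ^ q * binom)         ≡⟨ regroup (-1ℤ ^ q) (-1ℤ ^ k) binom ⟩
  -1ℤ * -1ℤ ^ k * ((-1ℤ ^ q * -1ℤ ^ q) * binom)         ≡⟨ cong (λ σ → -1ℤ * -1ℤ ^ k * (σ * binom)) (-1^n*-1^n≡1 q) ⟩
  -1ℤ * -1ℤ ^ k * (+ 1 * binom)                         ≡⟨ cong (-1ℤ * -1ℤ ^ k *_) (ℤₚ.*-identityˡ binom) ⟩
  -1ℤ ^ suc k * binom                                   ∎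
  where
  p = suc q
  L = suc q ℕ.+ k
  binom = (q ℕ.+ k) Cℤ q
  q≤L : q ≤ L
  q≤L = ℕₚ.≤-trans (ℕₚ.m≤m+n q k) (ℕₚ.n≤1+n _)
  vanishing : ∀ i → q < i → i ≤ L → L Cℤ i * (-1ℤ ^ i * δ p i) ≡ + 0
  vanishing i q<i _ = trans (cong (λ d → L Cℤ i * (-1ℤ ^ i * d)) (δ≡0 p i q<i)) (kill (L Cℤ i) (-1ℤ ^ i))
    where
    kill : ∀ c σ → c * (σ * + 0) ≡ + 0
    kill = solve-∀
  regroup : ∀ x y z → -1ℤ * (x * y) * (x * z) ≡ -1ℤ * y * ((x * x) * z)
  regroup = solve-∀

-- j counts the singletons and js the blocks of sizes 2, …, d + 2 of a partition of k + d + 2 < 2p into k + 1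
-- blocks. If the larger blocks have average size ≥ p, there is exactly one of them.
sparse-multiIndex : ∀ {p} k d j (js : Vec ℕ (suc d)) → k ℕ.+ suc (suc d) < p ℕ.+ p →
                    j ℕ.+ Vec.sum js ≡ suc k → 1 ℕ.* j ℕ.+ wsum 2 js ≡ k ℕ.+ suc (suc d) →
                    p ℕ.* Vec.sum js ≤ wsum 2 js → j ∷ js ≡ k ∷ singleBlock d
sparse-multiIndex {p} k d j js n<2p sum≡ wsum≡ p*sum≤ with Vec.sum js in sum-js
... | zero = ⊥-elim (ℕₚ.m≢1+m+n k (begin
  k                          ≡⟨ ℕₚ.suc-injective (trans (sym (trans (sym (ℕₚ.+-identityʳ j)) sum≡)) j≡n) ⟩
  k ℕ.+ suc d                ≡⟨ ℕₚ.+-suc k d ⟩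
  suc (k ℕ.+ d)              ∎))
  where
  j≡n : j ≡ suc (k ℕ.+ suc d)
  j≡n = trans (sym (trans (cong₂ ℕ._+_ (ℕₚ.*-identityˡ j) (sum≡0⇒wsum≡0 2 js sum-js)) (ℕₚ.+-identityʳ j)))
              (trans wsum≡ (ℕₚ.+-suc k (suc d)))
... | suc zero = cong₂ _∷_ j≡k (sum≡1⇒singleBlock 2 js sum-js wsum-js)
  where
  j≡k : j ≡ k
  j≡k = ℕₚ.suc-injective (trans (ℕₚ.+-comm 1 j) sum≡)
  wsum-js : wsum 2 js ≡ 2 ℕ.+ d
  wsum-js = ℕₚ.+-cancelˡ-≡ k _ _ (trans (cong₂ ℕ._+_ (sym j≡k) refl)
                                        (trans (cong (ℕ._+ wsum 2 js) (sym (ℕₚ.*-identityˡ j))) wsum≡))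
... | suc (suc r) = ⊥-elim (ℕₚ.<⇒≱ n<2p
  (ℕₚ.≤-trans (ℕₚ.≤-reflexive 2p≡p*2) (ℕₚ.≤-trans (ℕₚ.*-monoʳ-≤ p (s≤s (s≤s z≤n)))
  (ℕₚ.≤-trans p*sum≤ (ℕₚ.≤-trans (ℕₚ.m≤n+m (wsum 2 js) (1 ℕ.* j)) (ℕₚ.≤-reflexive wsum≡))))))
  where
  2p≡p*2 : p ℕ.+ p ≡ p ℕ.* 2
  2p≡p*2 = trans (cong (p ℕ.+_) (sym (ℕₚ.+-identityʳ p))) (ℕₚ.*-comm 2 p)

partialBell-diagonal : ∀ m x → partialBell (suc m) (suc m) x ≡ x 1 ^ suc m
partialBell-diagonal m x = begin
  partialBell (suc m) (suc m) x
    ≡⟨ partialBell≡partialBellOver (suc m) (suc m) x (cong suc (ℕₚ.n∸n≡0 m)) ⟩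
  partialBellOver 1 (suc m) (suc m) x
    ≡⟨ sumℤ-filter-tuples-single (isMultiIndex? (suc m) (suc m)) (bellTerm (suc m) x) (suc m ∷ []) (ℕₚ.≤-refl ∷ [])
         (ℕₚ.+-identityʳ (suc m) , trans (ℕₚ.+-identityʳ (1 ℕ.* suc m)) (ℕₚ.*-identityˡ (suc m)))
         (λ { (j ∷ []) (sum≡ , _) js≢ → ⊥-elim (js≢ (cong (_∷ []) (trans (sym (ℕₚ.+-identityʳ j)) sum≡))) }) ⟩
  + coeff (suc m) (suc m ∷ []) * (x 1 ^ suc m * + 1)
    ≡⟨ cong₂ (λ c v → + c * v) coeff≡1 (ℤₚ.*-identityʳ (x 1 ^ suc m)) ⟩
  + 1 * x 1 ^ suc m
    ≡⟨ ℤₚ.*-identityˡ _ ⟩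
  x 1 ^ suc m ∎
  where
  open ℕₚ using (_!≢0)
  coeff≡1 : coeff (suc m) (suc m ∷ []) ≡ 1
  coeff≡1 = trans (/-congʳ {{denom≢0 1 (suc m ∷ [])}} {{suc m !≢0}}
                     (trans (ℕₚ.*-identityʳ _) (trans (cong (suc m ! ℕ.*_) (ℕₚ.^-zeroˡ (suc m))) (ℕₚ.*-identityʳ _))))
                  (n/n≡1 (suc m !) {{suc m !≢0}})

module _ {p : ℕ} (x : ℕ → ℤ) (x₁≡1 : x 1 ≡ + 1) (sparse : ∀ i → 2 ≤ i → i < p → x i ≡ + 0) where

  p*j≤s*j : ∀ s j M → 2 ≤ s → x s ^ j * M ≢ + 0 → p ℕ.* j ≤ s ℕ.* j
  p*j≤s*j s zero    _ _   _      = ℕₚ.≤-reflexive (trans (ℕₚ.*-zeroʳ p) (sym (ℕₚ.*-zeroʳ s)))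
  p*j≤s*j s (suc j) M 2≤s mono≢0 with p ℕₚ.≤? s
  ... | yes p≤s = ℕₚ.*-monoˡ-≤ (suc j) p≤s
  ... | no  p≰s = ⊥-elim (mono≢0 (cong (λ v → v * x s ^ j * M) (sparse s 2≤s (ℕₚ.≰⇒> p≰s))))

  p*sum≤wsum : ∀ {m} s (js : Vec ℕ m) → 2 ≤ s → mono x s js ≢ + 0 → p ℕ.* Vec.sum js ≤ wsum s js
  p*sum≤wsum s []       _   _      = ℕₚ.≤-reflexive (ℕₚ.*-zeroʳ p)
  p*sum≤wsum s (j ∷ js) 2≤s mono≢0 = ℕₚ.≤-trans (ℕₚ.≤-reflexive (ℕₚ.*-distribˡ-+ p j (Vec.sum js)))
    (ℕₚ.+-mono-≤ (p*j≤s*j s j (mono x (suc s) js) 2≤s mono≢0)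
                 (p*sum≤wsum (suc s) js (ℕₚ.m≤n⇒m≤1+n 2≤s)
                             (λ mono≡0 → mono≢0 (trans (cong (x s ^ j *_) mono≡0) (ℤₚ.*-zeroʳ (x s ^ j))))))

  partialBell-twoSizes : ∀ k d → k ℕ.+ suc (suc d) < p ℕ.+ p →
                         partialBell (k ℕ.+ suc (suc d)) (suc k) x ≡ (k ℕ.+ suc (suc d)) Cℤ suc (suc d) * x (suc (suc d))
  partialBell-twoSizes k d n<2p = begin
    partialBell n (suc k) x           ≡⟨ partialBell≡partialBellOver n (suc k) x length≡ ⟩
    partialBellOver (suc (suc d)) n (suc k) x
      ≡⟨ sumℤ-filter-tuples-single (isMultiIndex? n (suc k)) (bellTerm n x) t (ℕₚ.n≤1+n k ∷ singleBlock≤ d (s≤s z≤n))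
                                   t-isMultiIndex others≡0 ⟩
    + coeff n t * (x 1 ^ k * mono x 2 (singleBlock d))
      ≡⟨ cong₂ (λ c v → + c * (x 1 ^ k * v)) (coeff-twoSizes k d) (mono-singleBlock x 2 d) ⟩
    n Cℤ suc (suc d) * (x 1 ^ k * x (suc (suc d)))
      ≡⟨ cong (λ v → n Cℤ suc (suc d) * (v ^ k * x (suc (suc d)))) x₁≡1 ⟩
    n Cℤ suc (suc d) * ((+ 1) ^ k * x (suc (suc d)))
      ≡⟨ cong (λ v → n Cℤ suc (suc d) * (v * x (suc (suc d)))) (ℤₚ.^-zeroˡ k) ⟩
    n Cℤ suc (suc d) * (+ 1 * x (suc (suc d)))
      ≡⟨ cong (n Cℤ suc (suc d) *_) (ℤₚ.*-identityˡ _) ⟩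
    n Cℤ suc (suc d) * x (suc (suc d)) ∎
    where
    n = k ℕ.+ suc (suc d)
    t = k ∷ singleBlock d
    length≡ : suc (n ∸ suc k) ≡ suc (suc d)
    length≡ = cong suc (trans (cong (_∸ suc k) (ℕₚ.+-suc k (suc d))) (ℕₚ.m+n∸m≡n k (suc d)))
    t-isMultiIndex : IsMultiIndex n (suc k) t
    t-isMultiIndex = trans (cong (k ℕ.+_) (sum-singleBlock d)) (ℕₚ.+-comm k 1)
                   , cong₂ ℕ._+_ (ℕₚ.*-identityˡ k) (wsum-singleBlock 2 d)
    others≡0 : ∀ js → IsMultiIndex n (suc k) js → js ≢ t → bellTerm n x js ≡ + 0
    others≡0 (j ∷ js) (sum≡ , wsum≡) js≢t with mono x 2 js ℤₚ.≟ + 0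
    ... | yes mono≡0 = trans (cong (λ v → + coeff n (j ∷ js) * (x 1 ^ j * v)) mono≡0)
                             (kill (+ coeff n (j ∷ js)) (x 1 ^ j))
      where
      kill : ∀ a b → a * (b * + 0) ≡ + 0
      kill = solve-∀
    ... | no  mono≢0 = ⊥-elim (js≢t (sparse-multiIndex {p} k d j js n<2p sum≡ wsum≡ (p*sum≤wsum 2 js ℕₚ.≤-refl mono≢0)))

  partialBell-sparse : ∀ m k → k < m → suc m < p ℕ.+ p →
                       partialBell (suc m) (suc k) x ≡ suc m Cℤ (suc m ∸ k) * x (suc m ∸ k)
  partialBell-sparse m k k<m 1+m<2p = begin
    partialBell (suc m) (suc k) x                       ≡⟨ cong (λ n → partialBell n (suc k) x) n≡1+m ⟨
    partialBell n (suc k) x                             ≡⟨ partialBell-twoSizes k d (subst (_< p ℕ.+ p) (sym n≡1+m) 1+m<2p) ⟩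
    n Cℤ suc (suc d) * x (suc (suc d))                  ≡⟨ cong (λ i → n Cℤ i * x i) (ℕₚ.m+n∸m≡n k (suc (suc d))) ⟨
    n Cℤ (n ∸ k) * x (n ∸ k)                            ≡⟨ cong (λ n → n Cℤ (n ∸ k) * x (n ∸ k)) n≡1+m ⟩
    suc m Cℤ (suc m ∸ k) * x (suc m ∸ k)                ∎
    where
    d = m ∸ suc k
    n = k ℕ.+ suc (suc d)
    n≡1+m : n ≡ suc m
    n≡1+m = trans (ℕₚ.+-comm k (suc (suc d))) (cong suc (trans (sym (ℕₚ.+-suc d k)) (ℕₚ.m∸n+n≡m k<m)))

  completeBell-sparse : ∀ (c : ℕ → ℤ) → c 0 ≡ + 1 → c 1 ≡ + 0 → (∀ i → 2 ≤ i → x i ≡ c i) →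
                        ∀ m → suc m < p ℕ.+ p → completeBell (suc m) x ≡ ∑[ i < suc (suc m) ] (suc m Cℤ i * c i)
  completeBell-sparse c c₀≡1 c₁≡0 x≡c m 1+m<2p = begin
    completeBell (suc m) x
      ≡⟨ sumℤ-upTo (λ k → partialBell (suc m) (suc k) x) (suc m) ⟩
    ∑[ k < m ] partialBell (suc m) (suc k) x + partialBell (suc m) (suc m) x
      ≡⟨ cong₂ _+_ (∑-cong m (λ k k<m → trans (partialBell-sparse m k k<m 1+m<2p)
                                              (cong (suc m Cℤ (suc m ∸ k) *_) (x≡c (suc m ∸ k) (2≤1+m∸k k<m)))))
                   (trans (partialBell-diagonal m x) (trans (cong (_^ suc m) x₁≡1) (ℤₚ.^-zeroˡ (suc m)))) ⟩
    ∑< m h + + 1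
      ≡⟨ cong (λ v → ∑< m h + v) (sym h[1+m]≡1) ⟩
    ∑< m h + h (suc m)
      ≡⟨ cong (λ v → v + h (suc m)) (trans (sym (ℤₚ.+-identityʳ (∑< m h))) (cong (_+_ (∑< m h)) (sym h[m]≡0))) ⟩
    ∑< (suc (suc m)) h
      ≡⟨ ∑-reverse h (suc (suc m)) ⟩
    ∑[ i < suc (suc m) ] h (suc m ∸ i)
      ≡⟨ ∑-cong (suc (suc m)) (λ i i≤1+m → cong (λ j → suc m Cℤ j * c j) (ℕₚ.m∸[m∸n]≡n (ℕₚ.≤-pred i≤1+m))) ⟩
    ∑[ i < suc (suc m) ] (suc m Cℤ i * c i) ∎
    where
    h : ℕ → ℤ
    h k = suc m Cℤ (suc m ∸ k) * c (suc m ∸ k)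
    2≤1+m∸k : ∀ {k} → k < m → 2 ≤ suc m ∸ k
    2≤1+m∸k {k} k<m = subst (2 ≤_) (sym (ℕₚ.+-∸-assoc 1 (ℕₚ.<⇒≤ k<m))) (s≤s (ℕₚ.m<n⇒0<n∸m k<m))
    h[m]≡0 : h m ≡ + 0
    h[m]≡0 = trans (cong (λ j → suc m Cℤ j * c j) (ℕₚ.m+n∸n≡m 1 m)) (trans (cong (suc m Cℤ 1 *_) c₁≡0) (ℤₚ.*-zeroʳ (suc m Cℤ 1)))
    h[1+m]≡1 : h (suc m) ≡ + 1
    h[1+m]≡1 = trans (cong (λ j → suc m Cℤ j * c j) (ℕₚ.n∸n≡0 (suc m))) (cong (+ 1 *_) c₀≡1)

nCk*k!*[n∸k]!≡n! : ∀ {n k} → k ≤ n → (n C k) ℕ.* (k ! ℕ.* (n ∸ k) !) ≡ n !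
nCk*k!*[n∸k]!≡n! {n} {k} k≤n = begin
  (n C k) ℕ.* (k ! ℕ.* (n ∸ k) !)                       ≡⟨ cong (ℕ._* (k ! ℕ.* (n ∸ k) !)) (nCk≡n!/k![n-k]! k≤n) ⟩
  (n ! ℕ./ (k ! ℕ.* (n ∸ k) !)) ℕ.* (k ! ℕ.* (n ∸ k) !) ≡⟨ m/n*n≡m (k![n∸k]!∣n! k≤n) ⟩
  n !                                                   ∎
  where instance _ = k ℕₚ.!* (n ∸ k) !≢0

-- The absorption identity: both sides times k! (n ∸ k ∸ 1)! equal n!.
[k+1]*nC[k+1]≡[n∸k]*nCk : ∀ {n k} → k < n → suc k ℕ.* (n C suc k) ≡ (n ∸ k) ℕ.* (n C k)
[k+1]*nC[k+1]≡[n∸k]*nCk {n} {k} k<n = ℕₚ.*-cancelʳ-≡ _ _ (k ! ℕ.* r !) {{k ℕₚ.!* r !≢0}} (begin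
  suc k ℕ.* (n C suc k) ℕ.* (k ! ℕ.* r !) ≡⟨ regroup₁ (suc k) (n C suc k) (k !) (r !) ⟩
  (n C suc k) ℕ.* (suc k ! ℕ.* r !)       ≡⟨ nCk*k!*[n∸k]!≡n! k<n ⟩
  n !                                     ≡⟨ nCk*k!*[n∸k]!≡n! (ℕₚ.<⇒≤ k<n) ⟨
  (n C k) ℕ.* (k ! ℕ.* (n ∸ k) !)         ≡⟨ cong (λ m → (n C k) ℕ.* (k ! ℕ.* m !)) n∸k≡1+r ⟩
  (n C k) ℕ.* (k ! ℕ.* (suc r ℕ.* r !))   ≡⟨ regroup₂ (n C k) (k !) (suc r) (r !) ⟩
  suc r ℕ.* (n C k) ℕ.* (k ! ℕ.* r !)     ≡⟨ cong (λ m → m ℕ.* (n C k) ℕ.* (k ! ℕ.* r !)) n∸k≡1+r ⟨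
  (n ∸ k) ℕ.* (n C k) ℕ.* (k ! ℕ.* r !)   ∎)
  where
  r = n ∸ suc k
  n∸k≡1+r : n ∸ k ≡ suc r
  n∸k≡1+r = ℕₚ.+-∸-assoc 1 k<n
  regroup₁ : ∀ a b c d → a ℕ.* b ℕ.* (c ℕ.* d) ≡ b ℕ.* ((a ℕ.* c) ℕ.* d)
  regroup₁ = ℕ-solve-∀
  regroup₂ : ∀ a b c d → a ℕ.* (b ℕ.* (c ℕ.* d)) ≡ c ℕ.* a ℕ.* (b ℕ.* d)
  regroup₂ = ℕ-solve-∀

n∣n! : ∀ n .{{_ : NonZero n}} → n ∣ n !
n∣n! (suc n) = m∣m*n (n !)

module _ {p : ℕ} (isPrime : Prime p) where

  private instance
    p≢0 : NonZero p
    p≢0 = prime⇒nonZero isPrime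

  p∤m! : ∀ {m} → m < p → p ∤ m !
  p∤m! {zero}  m<p p∣1 = ℕₚ.<⇒≱ (ℕ.nonTrivial⇒n>1 p {{prime⇒nonTrivial isPrime}}) (∣⇒≤ p∣1)
  p∤m! {suc m} m<p p∣m! with euclidsLemma (suc m) (m !) isPrime p∣m!
  ... | inj₁ p∣1+m = ℕₚ.<⇒≱ m<p (∣⇒≤ p∣1+m)
  ... | inj₂ p∣m!  = p∤m! (ℕₚ.<-trans (ℕₚ.n<1+n m) m<p) p∣m!

  p∣pCk : ∀ {k} → 0 < k → k < p → p ∣ p C k
  p∣pCk {k} 0<k k<p with euclidsLemma (p C k) (k ! ℕ.* (p ∸ k) !) isPrime p∣p!
    where p∣p! = subst (p ∣_) (sym (nCk*k!*[n∸k]!≡n! (ℕₚ.<⇒≤ k<p))) (n∣n! p)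
  ... | inj₁ p∣pCk = p∣pCk
  ... | inj₂ p∣k!*[p∸k]! with euclidsLemma (k !) ((p ∸ k) !) isPrime p∣k!*[p∸k]!
  ...   | inj₁ p∣k!     = contradiction p∣k! (p∤m! k<p)
  ...   | inj₂ p∣[p∸k]! = contradiction p∣[p∸k]! (p∤m! (ℕₚ.∸-monoʳ-< 0<k (ℕₚ.<⇒≤ k<p)))

  [p+n]Ck≡nCk[mod-p] : ∀ n k → k < p → ((p ℕ.+ n) C k) ℕ.% p ≡ (n C k) ℕ.% p
  [p+n]Ck≡nCk[mod-p] n       zero    _   = refl
  [p+n]Ck≡nCk[mod-p] zero    (suc k) k<p = begin
    ((p ℕ.+ 0) C suc k) ℕ.% p ≡⟨ cong (λ m → (m C suc k) ℕ.% p) (ℕₚ.+-identityʳ p) ⟩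
    (p C suc k) ℕ.% p         ≡⟨ n∣m⇒m%n≡0 _ p (p∣pCk (s≤s z≤n) k<p) ⟩
    0                         ≡⟨ n∣m⇒m%n≡0 0 p (p ∣0) ⟨
    (0 C suc k) ℕ.% p         ∎
  [p+n]Ck≡nCk[mod-p] (suc n) (suc k) k<p = begin
    ((p ℕ.+ suc n) C suc k) ℕ.% p
      ≡⟨ cong (λ m → (m C suc k) ℕ.% p) (ℕₚ.+-suc p n) ⟩
    (suc (p ℕ.+ n) C suc k) ℕ.% p
      ≡⟨ cong (ℕ._% p) (nCk+nC[k+1]≡[n+1]C[k+1] (p ℕ.+ n) k) ⟨
    ((p ℕ.+ n) C k ℕ.+ (p ℕ.+ n) C suc k) ℕ.% p
      ≡⟨ %-distribˡ-+ ((p ℕ.+ n) C k) _ p ⟩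
    (((p ℕ.+ n) C k) ℕ.% p ℕ.+ ((p ℕ.+ n) C suc k) ℕ.% p) ℕ.% p
      ≡⟨ cong₂ (λ a b → (a ℕ.+ b) ℕ.% p) ([p+n]Ck≡nCk[mod-p] n k (ℕₚ.<-trans (ℕₚ.n<1+n k) k<p))
                                          ([p+n]Ck≡nCk[mod-p] n (suc k) k<p) ⟩
    ((n C k) ℕ.% p ℕ.+ (n C suc k) ℕ.% p) ℕ.% p
      ≡⟨ %-distribˡ-+ (n C k) _ p ⟨
    (n C k ℕ.+ n C suc k) ℕ.% p
      ≡⟨ cong (ℕ._% p) (nCk+nC[k+1]≡[n+1]C[k+1] n k) ⟩
    (suc n C suc k) ℕ.% p
      ∎

  k*[q+k]Cq≡p-mod-p² : ∀ {q} k → p ≡ suc q → suc k < p →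
                       Σ ℕ λ e → suc k ℕ.* ((q ℕ.+ suc k) C q) ≡ p ℕ.+ p ℕ.* p ℕ.* e
  k*[q+k]Cq≡p-mod-p² {q} k refl k<p = E ℕ./ p , (begin
    suc k ℕ.* (N C q)           ≡⟨ cong (ℕ._* (N C q)) (ℕₚ.m+n∸m≡n q (suc k)) ⟨
    (N ∸ q) ℕ.* (N C q)         ≡⟨ [k+1]*nC[k+1]≡[n∸k]*nCk (ℕₚ.m<m+n q (s≤s z≤n)) ⟨
    p ℕ.* E                     ≡⟨ cong (p ℕ.*_) E≡1+[E/p]*p ⟩
    p ℕ.* (1 ℕ.+ E ℕ./ p ℕ.* p) ≡⟨ distribute p (E ℕ./ p) ⟩
    p ℕ.+ p ℕ.* p ℕ.* (E ℕ./ p) ∎)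
    where
    N = q ℕ.+ suc k
    E = N C p
    N≡p+k : N ≡ p ℕ.+ k
    N≡p+k = ℕₚ.+-suc q k
    E%p≡1 : E ℕ.% p ≡ 1
    E%p≡1 = begin
      (N C p) ℕ.% p                     ≡⟨ cong (λ n → (n C p) ℕ.% p) N≡p+k ⟩
      ((p ℕ.+ k) C p) ℕ.% p             ≡⟨ cong (ℕ._% p) (nCk≡nC[n∸k] (ℕₚ.m≤m+n p k)) ⟩
      ((p ℕ.+ k) C (p ℕ.+ k ∸ p)) ℕ.% p ≡⟨ cong (λ m → ((p ℕ.+ k) C m) ℕ.% p) (ℕₚ.m+n∸m≡n p k) ⟩
      ((p ℕ.+ k) C k) ℕ.% p             ≡⟨ [p+n]Ck≡nCk[mod-p] k k (ℕₚ.<-trans (ℕₚ.n<1+n k) k<p) ⟩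
      (k C k) ℕ.% p                     ≡⟨ cong (ℕ._% p) (nCn≡1 k) ⟩
      1 ℕ.% p                           ≡⟨ m<n⇒m%n≡m (ℕ.nonTrivial⇒n>1 p {{prime⇒nonTrivial isPrime}}) ⟩
      1                                 ∎
    E≡1+[E/p]*p : E ≡ 1 ℕ.+ E ℕ./ p ℕ.* p
    E≡1+[E/p]*p = trans (m≡m%n+[m/n]*n E p) (cong (ℕ._+ E ℕ./ p ℕ.* p) E%p≡1)
    distribute : ∀ p e → p ℕ.* (1 ℕ.+ e ℕ.* p) ≡ p ℕ.+ p ℕ.* p ℕ.* e
    distribute = ℕ-solve-∀

toℚᵘ-/ : ∀ (i : ℤ) n → toℚᵘ (i ℚ./ suc n) ℚᵘ.≃ ℚᵘ.mkℚᵘ i n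
toℚᵘ-/ i n = ℚₚ.toℚᵘ-fromℚᵘ (ℚᵘ.mkℚᵘ i n)

/-sub : ∀ (X Y Z W : ℤ) k → + suc k * X ≡ Y + W * Z →
        (X ℚ./ 1) ℚ.- (Y ℚ./ suc k) ≡ (W ℚ./ 1) ℚ.* (Z ℚ./ suc k)
/-sub X Y Z W k eq = ℚₚ.toℚᵘ-injective (begin-≃
  toℚᵘ ((X ℚ./ 1) ℚ.- (Y ℚ./ suc k))                   ≈⟨ ℚₚ.toℚᵘ-homo-+ (X ℚ./ 1) (ℚ.- (Y ℚ./ suc k)) ⟩
  toℚᵘ (X ℚ./ 1) ℚᵘ.+ toℚᵘ (ℚ.- (Y ℚ./ suc k))        ≈⟨ ℚᵘₚ.+-cong (toℚᵘ-/ X 0) (ℚᵘₚ.≃-trans (ℚₚ.toℚᵘ-homo‿- (Y ℚ./ suc k)) (ℚᵘₚ.-‿cong (toℚᵘ-/ Y k))) ⟩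
  ℚᵘ.mkℚᵘ X 0 ℚᵘ.- ℚᵘ.mkℚᵘ Y k                         ≈⟨ ℚᵘ.*≡* (cong (_* + suc (k ℕ.+ 0 ℕ.* suc k)) cross) ⟩
  ℚᵘ.mkℚᵘ W 0 ℚᵘ.* ℚᵘ.mkℚᵘ Z k                         ≈⟨ ℚᵘₚ.*-cong (toℚᵘ-/ W 0) (toℚᵘ-/ Z k) ⟨
  toℚᵘ (W ℚ./ 1) ℚᵘ.* toℚᵘ (Z ℚ./ suc k)              ≈⟨ ℚₚ.toℚᵘ-homo-* (W ℚ./ 1) (Z ℚ./ suc k) ⟨
  toℚᵘ ((W ℚ./ 1) ℚ.* (Z ℚ./ suc k))                   ∎-≃)
  where
  open ℚᵘₚ.≃-Reasoning using (step-≈-⟩; step-≈-⟨) renaming (begin_ to begin-≃_; _∎ to _∎-≃)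
  cross : X * + suc k + (- Y) * + 1 ≡ W * Z
  cross = trans (rearrange X (+ suc k) Y) (trans (cong (_+ - Y) eq) (cancel Y (W * Z)))
    where
    rearrange : ∀ X K Y → X * K + (- Y) * + 1 ≡ K * X + - Y
    rearrange = solve-∀
    cancel : ∀ Y V → (Y + V) + - Y ≡ V
    cancel = solve-∀

-- The reduced denominator of i / (n + 1) divides n + 1 < p.
/-denominator-small : ∀ {p} (i : ℤ) n → suc n < p → InZ₍p₎ p (i ℚ./ suc n)
/-denominator-small {p} i n n<p p∣den = ℕₚ.<⇒≱ n<p (∣⇒≤ (∣-trans p∣den (divides g (trans (sym den*g≡n) (ℕₚ.*-comm _ g)))))
  where
  g = gcd ℤ.∣ i ∣ (suc n)
  den*g≡n : ↧ₙ (i ℚ./ suc n) ℕ.* g ≡ suc n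
  den*g≡n = ℤₚ.+-injective (trans (ℤₚ.pos-* (↧ₙ (i ℚ./ suc n)) g) (ℚₚ.↧-/ i (suc n)))

CongModSq-intro : ∀ {p} k (X Y Z : ℤ) → suc k < p → + suc k * X ≡ Y + + (p ℕ.* p) * Z →
                  CongModSq p (X ℚ./ 1) (Y ℚ./ suc k)
CongModSq-intro {p} k X Y Z k<p eq = Z ℚ./ suc k , /-denominator-small Z k k<p , /-sub X Y Z (+ (p ℕ.* p)) k eq

δ-preimage : ℕ → ℕ → ℤ
δ-preimage p zero          = + 0
δ-preimage p 1             = + 1
δ-preimage p (suc (suc i)) = Δ^ (suc (suc i)) (δ p) 0

module _ {p : ℕ} (2≤p : 2 ≤ p) where

  δ-preimage-small : ∀ i → 2 ≤ i → i ≤ p ∸ 1 → δ-preimage p i ≡ + 0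
  δ-preimage-small 1             (s≤s ()) _
  δ-preimage-small (suc (suc i)) _        i≤ = Δ^δ-small p (suc (suc i)) (s≤s z≤n) i≤

  completeBell-δ-preimage : ∀ m → suc m < p ℕ.+ p → completeBell (suc m) (δ-preimage p) ≡ δ p (suc m)
  completeBell-δ-preimage m 1+m<2p = begin
    completeBell (suc m) (δ-preimage p)                      ≡⟨ completeBell-sparse (δ-preimage p) refl sparse c c₀≡1 c₁≡0 x≡c m 1+m<2p ⟩
    ∑[ i < suc (suc m) ] (suc m Cℤ i * Δ^ i (δ p) 0)          ≡⟨ Δ^-newton (δ p) (suc m) ⟩
    δ p (suc m)                                              ∎
    where
    c : ℕ → ℤ
    c i = Δ^ i (δ p) 0
    c₀≡1 : c 0 ≡ + 1
    c₀≡1 = δ≡1 p 0 z≤n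
    c₁≡0 : c 1 ≡ + 0
    c₁≡0 = Δ^δ-small p 1 ℕₚ.≤-refl (ℕₚ.<⇒≤pred 2≤p)
    sparse : ∀ i → 2 ≤ i → i < p → δ-preimage p i ≡ + 0
    sparse i 2≤i i<p = δ-preimage-small i 2≤i (ℕₚ.<⇒≤pred i<p)
    x≡c : ∀ i → 2 ≤ i → δ-preimage p i ≡ c i
    x≡c 1             (s≤s ())
    x≡c (suc (suc i)) _        = refl

δ-preimage-large : ∀ q k → 1 ≤ q → δ-preimage (suc q) (suc q ℕ.+ k) ≡ -1ℤ ^ suc k * (q ℕ.+ k) Cℤ q
δ-preimage-large (suc q) k _ = Δ^δ-large (suc q) k

δ-preimage-p≡-1 : ∀ q → 1 ≤ q → δ-preimage (suc q) (suc q) ≡ -1ℤ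
δ-preimage-p≡-1 q 1≤q = begin
  δ-preimage (suc q) (suc q)         ≡⟨ cong (δ-preimage (suc q)) (ℕₚ.+-identityʳ (suc q)) ⟨
  δ-preimage (suc q) (suc q ℕ.+ 0)   ≡⟨ δ-preimage-large q 0 1≤q ⟩
  -1ℤ ^ 1 * (q ℕ.+ 0) Cℤ q           ≡⟨ cong (λ n → -1ℤ ^ 1 * + (n C q)) (ℕₚ.+-identityʳ q) ⟩
  -1ℤ ^ 1 * q Cℤ q                   ≡⟨ cong (λ c → -1ℤ ^ 1 * + c) (nCn≡1 q) ⟩
  -1ℤ                                ∎

δ-preimage-congruence : ∀ {q} → Prime (suc q) → ∀ k → suc k < suc q →
                        CongModSq (suc q) (δ-preimage (suc q) (suc q ℕ.+ suc k) ℚ./ 1)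
                                          ((-1ℤ ^ suc (suc k) * + suc q) ℚ./ suc k)
δ-preimage-congruence {q} isPrime k k<p with k*[q+k]Cq≡p-mod-p² isPrime k refl k<p
... | e , k*C≡p+p²e = subst (λ v → CongModSq p (v ℚ./ 1) ((σ * + p) ℚ./ suc k))
                            (sym (δ-preimage-large q (suc k) (ℕₚ.≤-trans (s≤s z≤n) (ℕₚ.≤-pred k<p))))
                            (CongModSq-intro k (σ * binom) (σ * + p) (σ * + e) k<p k*σC≡σp+p²σe)
  where
  p = suc q
  σ = -1ℤ ^ suc (suc k)
  binom = (q ℕ.+ suc k) Cℤ q
  k*σC≡σp+p²σe : + suc k * (σ * binom) ≡ σ * + p + + (p ℕ.* p) * (σ * + e)
  k*σC≡σp+p²σe = begin
    + suc k * (σ * binom)                 ≡⟨ swap (+ suc k) σ binom ⟩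
    σ * (+ suc k * binom)                 ≡⟨ cong (σ *_) (ℤₚ.pos-* (suc k) ((q ℕ.+ suc k) C q)) ⟨
    σ * + (suc k ℕ.* ((q ℕ.+ suc k) C q)) ≡⟨ cong (λ n → σ * + n) k*C≡p+p²e ⟩
    σ * + (p ℕ.+ p ℕ.* p ℕ.* e)           ≡⟨ cong (σ *_) (trans (ℤₚ.pos-+ p (p ℕ.* p ℕ.* e)) (cong (_+_ (+ p)) (ℤₚ.pos-* (p ℕ.* p) e))) ⟩
    σ * (+ p + + (p ℕ.* p) * + e)         ≡⟨ distribute σ (+ p) (+ (p ℕ.* p)) (+ e) ⟩
    σ * + p + + (p ℕ.* p) * (σ * + e)     ∎
    where
    swap : ∀ a b c → a * (b * c) ≡ b * (a * c)
    swap = solve-∀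
    distribute : ∀ s a b c → s * (a + b * c) ≡ s * a + b * (s * c)
    distribute = solve-∀

δ-preimageVec : ℕ → (N : ℕ) → Vec ℤ N
δ-preimageVec p N = tabulate (λ i → δ-preimage p (suc (toℕ i)))

𝔹-δ-preimageVec : ∀ {p} N → 2 ≤ p → N < p ℕ.+ p → 𝔹 N (δ-preimageVec p N) ≡ δvec p N
𝔹-δ-preimageVec {p} N 2≤p N<2p = Vecₚ.tabulate-cong λ j →
  trans (completeBell-local (suc (toℕ j)) _ (δ-preimage p)
          (λ i 1≤i i≤ → entry-tabulate (δ-preimage p) i 1≤i (ℕₚ.≤-trans i≤ (Finₚ.toℕ<n j))))
        (completeBell-δ-preimage 2≤p (toℕ j) (ℕₚ.≤-<-trans (Finₚ.toℕ<n j) N<2p))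

proposition2p4 : (p : ℕ) → Prime p → 3 ≤ p →
    ((n : ℕ) → 1 ≤ n → Bijective _≡_ _≡_ (𝔹 n))
    ×
    ((i : ℕ) → 1 ≤ i → i ≤ p ∸ 1 →
      Σ (Vec ℤ (p ℕ.+ i)) (λ y →
        𝔹 (p ℕ.+ i) y ≡ δvec p (p ℕ.+ i)
        × entry y 1 ≡ + 1
        × ((j : ℕ) → 2 ≤ j → j ≤ p ∸ 1 → entry y j ≡ + 0)
        × entry y p ≡ -[1+ 0 ]
        × ((k : ℕ) → 1 ≤ k → k ≤ i →
            CongModSq p ((entry y (p ℕ.+ k)) ℚ./ 1)
                        ((((-[1+ 0 ]) ℤ.^ (suc k)) ℤ.* (+ p)) ℚ./ (suc (k ∸ 1))))))
proposition2p4 zero      _       ()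
proposition2p4 p@(suc q) isPrime 3≤p = (λ n _ → 𝔹-bijective n) , λ i _ i≤q →
    δ-preimageVec p (p ℕ.+ i)
  , 𝔹-δ-preimageVec (p ℕ.+ i) 2≤p (ℕₚ.+-monoʳ-< p (s≤s i≤q))
  , entry-δ-preimageVec 1 (s≤s z≤n) (ℕₚ.m≤n⇒m≤n+o i (s≤s (z≤n {q})))
  , (λ j 2≤j j≤q → trans (entry-δ-preimageVec j (ℕₚ.≤-trans (s≤s z≤n) 2≤j) (ℕₚ.m≤n⇒m≤n+o i (ℕₚ.m≤n⇒m≤1+n j≤q)))
                         (δ-preimage-small 2≤p j 2≤j j≤q))
  , trans (entry-δ-preimageVec p (s≤s z≤n) (ℕₚ.m≤m+n p i)) (δ-preimage-p≡-1 q 1≤q)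
  , λ { (suc k) _ k<i → subst (λ v → CongModSq p (v ℚ./ 1) _)
                              (sym (entry-δ-preimageVec (p ℕ.+ suc k) (s≤s z≤n) (ℕₚ.+-monoʳ-≤ p k<i)))
                              (δ-preimage-congruence isPrime k (s≤s (ℕₚ.≤-trans k<i i≤q))) }
  where
  2≤p : 2 ≤ p
  2≤p = ℕₚ.≤-trans (ℕₚ.n≤1+n 2) 3≤p
  1≤q : 1 ≤ q
  1≤q = ℕₚ.≤-pred 2≤p
  entry-δ-preimageVec : ∀ {N} j → 1 ≤ j → j ≤ N → entry (δ-preimageVec p N) j ≡ δ-preimage p j
  entry-δ-preimageVec = entry-tabulate (δ-preimage p)
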